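{- Let $s_1,\dots,s_v\ge 2$ be distinct integers, $k_1,\dots,k_v\ge1$, and let $N$ be such that an $OA(N,s_1^{k_1}s_2^{k_2}\cdots s_v^{k_v})$ exists. Then the height of the node $(N,s_1^{k_1}\cdots s_v^{k_v})$ in $\Lambda_N$ equals $$k_1\,ht(s_1)+k_2\,ht(s_2)+\cdots+k_v\,ht(s_v),$$ where $ht(s)$ denotes the height of the lattice $\Lambda_s$. In particular this height does not depend on $N$.
   Context: An orthogonal array $OA(N, s_1^{k_1} s_2^{k_2}\cdots s_v^{k_v})$ (of strength 2) is an $N\times k$ array, $k=k_1+\cdots+k_v$, whose first $k_1$ columns have entries from $\{0,\dots,s_1-1\}$, next $k_2$ columns entries from $\{0,\dots,s_2-1\}$, etc., such that in every $N\times 2$ subarray every possible ordered pair of symbols occurs equally often as a row. One also allows the trivial $OA(N,1^1)$ (a column of $N$ zeros). The symbol $(N,s_1^{k_1}\cdots)$ is a parameter set; it is realized if such an array exists. Expansive replacement: given an $OA$ with $N$ runs and a column with $S$ levels, and an orthogonal array $B$ with $S$ runs (possibly the trivial $OA(S,1^1)$), replace that column by the rows of $B$ (symbol $j$ by the $j$-th row of $B$); this includes deleting a factor and replacing an $s$-level factor by an $s'$-level one when $s'\mid s$. $P$ is dominated by $Q$ if an array with parameter set $P$ can be obtained from one with parameter set $Q$ by a finite sequence of expansive replacements. $\Lambda_N$ is the set of realized parameter sets with $N$ runs ordered by dominance, a lattice with maximum $(N,N^1)$ and minimum $(N,1^1)$. The height of a node is the number of edges in a longest downward path from it to $(N,1^1)$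 in the Hasse diagram; the height of $\Lambda_N$ is the height of $(N,N^1)$. -}

module Defs where

open import Data.Nat using (ℕ; zero; suc; _+_; _*_; _≤_)
open import Data.Bool using (Bool; true; false; if_then_else_; _∧_)
open import Data.Fin using (Fin; _≟_)
open import Data.List using (List; []; _∷_; length; lookup; allFin; removeAt; _++_; map; concatMap; replicate)
open import Data.Nat.ListAction using (sum)
open import Data.List.Relation.Unary.All using (All)
open import Data.List.Relation.Binary.Permutation.Propositional using (_↭_)
open import Data.Product using (Σ; _×_)
open import Data.Empty using (⊥)
open import Relation.Nullary using (¬_)
open import Relation.Nullary.Decidable using (⌊_⌋)
open import Relation.Binary.PropositionalEquality using (_≡_; _≢_)

-- A parameter set (N, s_1^{k_1} ... ) is represented by N together with the
-- list of levels of its columns (each level ≥ 2), taken up to permutation (_↭_).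
-- The empty list of levels represents the trivial parameter set (N, 1^1).
Levels : Set
Levels = List ℕ

Array : ℕ → Levels → Set
Array N ls = Fin N → (j : Fin (length ls)) → Fin (lookup ls j)

countRows : (N : ℕ) → (Fin N → Bool) → ℕ
countRows N f = sum (map (λ r → if f r then 1 else 0) (allFin N))

IsOA : (N : ℕ) (ls : Levels) → Array N ls → Set
IsOA N ls A =
  ((i : Fin (length ls)) (a a' : Fin (lookup ls i)) →
     countRows N (λ r → ⌊ A r i ≟ a ⌋) ≡ countRows N (λ r → ⌊ A r i ≟ a' ⌋))
  × ((i j : Fin (length ls)) → i ≢ j →
     (a a' : Fin (lookup ls i)) (b b' : Fin (lookup ls j)) →
     countRows N (λ r → ⌊ A r i ≟ a ⌋ ∧ ⌊ A r j ≟ b ⌋)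
       ≡ countRows N (λ r → ⌊ A r i ≟ a' ⌋ ∧ ⌊ A r j ≟ b' ⌋))

Realized : ℕ → Levels → Set
Realized N ls = All (2 ≤_) ls × Σ (Array N ls) (IsOA N ls)

-- One expansive replacement, at the level of parameter sets: column i of Q
-- (with S = lookup Q i levels) is replaced by the columns of a realized
-- OA(S, ls'); ls' = [] means the trivial OA(S,1^1), i.e. deleting the factor.
Step : Levels → Levels → Set
Step Q P = Σ (Fin (length Q)) λ i → Σ Levels λ ls' →
  Realized (lookup Q i) ls' × (P ↭ (removeAt Q i ++ ls'))

data Reach : Levels → Levels → Set where
  done : ∀ {P Q} → P ↭ Q → Reach P Q
  step : ∀ {P Q R} → Step Q R → Reach P R → Reach P Q

Dom : ℕ → Levels → Levels → Set
Dom N P Q = Realized N P × Realized N Q × Reach P Q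

StrictDom : ℕ → Levels → Levels → Set
StrictDom N P Q = Dom N P Q × ¬ Dom N Q P

Covers : ℕ → Levels → Levels → Set
Covers N P Q = StrictDom N P Q ×
  ((Z : Levels) → StrictDom N P Z → StrictDom N Z Q → ⊥)

data DownPath (N : ℕ) : Levels → ℕ → Set where
  bottom : DownPath N [] zero
  down   : ∀ {P Q h} → Covers N P Q → DownPath N P h → DownPath N Q (suc h)

IsHeight : ℕ → Levels → ℕ → Set
IsHeight N Q h = DownPath N Q h × ((m : ℕ) → DownPath N Q m → m ≤ h)

levelsOf : (v : ℕ) → (Fin v → ℕ) → (Fin v → ℕ) → Levels
levelsOf v s k = concatMap (λ i → replicate (k i) (s i)) (allFin v)

ΣFin : (v : ℕ) → (Fin v → ℕ) → ℕ
ΣFin v f = sum (map f (allFin v))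

{-# OPTIONS --safe #-}
module Submission where

-- Give a parameter set P the weight w(P) = Σ_{s ∈ P} ht s, where ht q = 1 + max w(L) over the realized
-- L ≠ (q) with q runs. This is a well-founded recursion over a finite, decidable set: the levels
-- of such an L are < q and it has at most 2^q columns. Replacing an s-level column by a realized
-- OA(s, L) changes the weight by w(L) − ht s, which is 0 for L = (s) (a reordering of columns)
-- and negative otherwise. So strict dominance lowers the weight and a downward path from P has at
-- most w(P) edges. Conversely, replacing a column s by a maximising L lowers the weight by exactly
-- one, hence is a covering, and iterating gives a path of length w(P). So P has height w(P), and
-- the node (s) of Λ_s has height ht s.

open import Data.Bool using (Bool; true; false; if_then_else_; _∧_; T)
open import Data.Bool.Properties using (T-∧; ∧-comm)
open import Data.Empty using (⊥)
open import Data.Fin using (Fin; zero; suc; _≟_; toℕ; fromℕ<; combine; remQuot; inject≤; funToFin; finToFun)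
open import Data.Fin.Properties
  using (injective⇒≤; combine-remQuot; finToFun-funToFin; any?; all?; toℕ<n; toℕ-fromℕ<)
import Data.Fin.Properties as Fin
open import Data.List
  using (List; []; _∷_; _++_; length; lookup; allFin; tabulate; map; filter; cartesianProductWith; removeAt; replicate; concatMap)
open import Data.List.Extrema.Nat using (max; xs≤max; argmax-sel)
open import Data.List.Membership.Propositional using (_∈_)
open import Data.List.Membership.Propositional.Properties
  using (∈-lookup; ∈-cartesianProductWith⁺; ∈-allFin; ∈-map⁺; ∈-map⁻; ∈-filter⁺; ∈-filter⁻)
open import Data.List.Properties
  using (map-tabulate; map-cong; map-∘; map-++; tabulate-lookup; length-map; ≡-dec)
open import Data.List.Relation.Binary.Permutation.Propositional
  using (_↭_; ↭-refl; ↭-sym; ↭-trans; prep; swap)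
open import Data.List.Relation.Binary.Permutation.Propositional.Properties using (map⁺; ++-comm; All-resp-↭)
open import Data.List.Relation.Unary.All using (All; []; _∷_)
import Data.List.Relation.Unary.All as All
open import Data.List.Relation.Unary.All.Properties using (tabulate⁺; ++⁺)
open import Data.List.Relation.Unary.Any using (here; there)
open import Data.Nat using (ℕ; zero; suc; _+_; _*_; _^_; _≤_; _<_; z≤n; s≤s; >-nonZero; _≤?_)
  renaming (_≟_ to _≟ℕ_)
open import Data.Nat.Induction using (<-rec; <-wellFounded)
open import Data.Nat.ListAction using (sum)
open import Data.Nat.ListAction.Properties using (sum-++; sum-↭)
open import Data.Nat.Properties
  using ( +-*-semiring; *-zeroʳ; *-identityʳ; *-identityˡ; +-identityʳ; +-comm; +-monoʳ-<
        ; ≤-trans; ≤-reflexive; ≤-pred; <-trans; <-irrefl; <-asym; <⇒≤; <⇒≱; ≤∧≢⇒<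
        ; m≤n+m; m<m*n; n<1+n; suc-injective; module ≤-Reasoning)
open import Algebra.Properties.Semiring.Sum +-*-semiring
  using (∑-comm; sum-cong-≗; sum-replicate-zero; *-distribˡ-sum; *-distribʳ-sum)
  renaming (sum to ∑)
open import Data.Product using (∃; Σ; _×_; _,_; proj₁; proj₂)
import Data.Product as Product
open import Data.Sum using (_⊎_; inj₁; inj₂)
open import Function using (id; _∘_; Equivalence)
open import Function.Definitions using (Injective)
open import Induction.WellFounded using (module FixPoint)
open import Relation.Binary.Definitions using (Reflexive; _Respects_)
open import Relation.Binary.PropositionalEquality
open import Relation.Nullary using (¬_)
open import Relation.Nullary.Decidable
  using (Dec; ⌊_⌋; yes; no; toWitness; fromWitness; _×-dec_; _→-dec_; ¬?)
import Relation.Nullary.Decidable as Dec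
open import Relation.Nullary.Negation using (contradiction)
open import Relation.Unary using (Decidable)

open import Defs

-- Counting rows

𝟙 : Bool → ℕ
𝟙 b = if b then 1 else 0

_≐_ : ∀ {n} → Fin n → Fin n → Bool
x ≐ y = ⌊ x ≟ y ⌋

≐-suc : ∀ {n} (x y : Fin n) → (suc x ≐ suc y) ≡ (x ≐ y)
≐-suc x y with x ≟ y
... | yes _ = refl
... | no _ = refl

≐-sym : ∀ {n} (x y : Fin n) → (x ≐ y) ≡ (y ≐ x)
≐-sym x y with x ≟ y | y ≟ x
... | yes _ | yes _ = refl
... | no _ | no _ = refl
... | yes x≡y | no y≢x = contradiction (sym x≡y) y≢x
... | no x≢y | yes y≡x = contradiction (sym y≡x) x≢y

≐-refl : ∀ {n} (x : Fin n) → T (x ≐ x)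
≐-refl x = fromWitness refl

sum-tabulate : ∀ {n} (f : Fin n → ℕ) → sum (tabulate f) ≡ ∑ f
sum-tabulate {zero} f = refl
sum-tabulate {suc n} f = cong (f zero +_) (sum-tabulate (f ∘ suc))

countRows≡∑ : ∀ N (P : Fin N → Bool) → countRows N P ≡ ∑ (𝟙 ∘ P)
countRows≡∑ N P = trans (cong sum (map-tabulate id (𝟙 ∘ P))) (sum-tabulate (𝟙 ∘ P))

countRows-cong : ∀ {N} {P Q : Fin N → Bool} → (∀ r → P r ≡ Q r) → countRows N P ≡ countRows N Q
countRows-cong {N} e = cong sum (map-cong (cong 𝟙 ∘ e) (allFin N))

∑-δ : ∀ {n} (x : Fin n) (g : Fin n → ℕ) → ∑ (λ c → g c * 𝟙 (x ≐ c)) ≡ g x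
∑-δ {suc n} zero g = begin
  g zero * 1 + ∑ (λ c → g (suc c) * 0)  ≡⟨ cong₂ _+_ (*-identityʳ (g zero)) (sum-cong-≗ (*-zeroʳ ∘ g ∘ suc)) ⟩
  g zero + ∑ {n} (λ _ → 0)              ≡⟨ cong (g zero +_) (sum-replicate-zero n) ⟩
  g zero + 0                            ≡⟨ +-identityʳ (g zero) ⟩
  g zero                                ∎
  where open ≡-Reasoning
∑-δ {suc n} (suc x) g = begin
  g zero * 0 + ∑ (λ c → g (suc c) * 𝟙 (suc x ≐ suc c))
    ≡⟨ cong₂ _+_ (*-zeroʳ (g zero)) (sum-cong-≗ (cong (λ b → g (suc _) * 𝟙 b) ∘ ≐-suc x)) ⟩
  ∑ (λ c → g (suc c) * 𝟙 (x ≐ c))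
    ≡⟨ ∑-δ x (g ∘ suc) ⟩
  g (suc x)
    ∎
  where open ≡-Reasoning

countRows-≐ : ∀ n (a : Fin n) → countRows n (_≐ a) ≡ 1
countRows-≐ n a = begin
  countRows n (_≐ a)              ≡⟨ countRows≡∑ n (_≐ a) ⟩
  ∑ (λ r → 𝟙 (r ≐ a))             ≡˘⟨ sum-cong-≗ (λ r → trans (*-identityˡ _) (cong 𝟙 (≐-sym a r))) ⟩
  ∑ (λ r → 1 * 𝟙 (a ≐ r))         ≡⟨ ∑-δ a (λ _ → 1) ⟩
  1                               ∎
  where open ≡-Reasoning

𝟙-∧-swap : ∀ b p e → 𝟙 p * 𝟙 (b ∧ e) ≡ 𝟙 (b ∧ p) * 𝟙 e
𝟙-∧-swap false p e = *-zeroʳ (𝟙 p)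
𝟙-∧-swap true p e = refl

𝟙-∧-fibres : ∀ {q} (b : Bool) (P : Fin q → Bool) (x : Fin q) →
  ∑ (λ c → 𝟙 (P c) * 𝟙 (b ∧ x ≐ c)) ≡ 𝟙 (b ∧ P x)
𝟙-∧-fibres b P x = trans (sum-cong-≗ (λ c → 𝟙-∧-swap b (P c) (x ≐ c))) (∑-δ x (λ c → 𝟙 (b ∧ P c)))

countRows-∘ : ∀ {N q} (f : Fin N → Fin q) (R : Fin N → Bool) (P : Fin q → Bool) {μ : ℕ} →
  (∀ c → countRows N (λ r → R r ∧ f r ≐ c) ≡ μ) →
  countRows N (λ r → R r ∧ P (f r)) ≡ countRows q P * μ
countRows-∘ {N} {q} f R P {μ} fibre = begin
  countRows N (λ r → R r ∧ P (f r))                ≡⟨ countRows≡∑ N _ ⟩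
  ∑ (λ r → 𝟙 (R r ∧ P (f r)))                      ≡˘⟨ sum-cong-≗ (λ r → 𝟙-∧-fibres (R r) P (f r)) ⟩
  ∑ (λ r → ∑ (λ c → 𝟙 (P c) * indicator r c))      ≡⟨ ∑-comm (λ r c → 𝟙 (P c) * indicator r c) ⟩
  ∑ (λ c → ∑ (λ r → 𝟙 (P c) * indicator r c))      ≡˘⟨ sum-cong-≗ (λ c → *-distribˡ-sum (𝟙 (P c)) (λ r → indicator r c)) ⟩
  ∑ (λ c → 𝟙 (P c) * ∑ (λ r → indicator r c))      ≡⟨ sum-cong-≗ (λ c → cong (𝟙 (P c) *_) (fibre′ c)) ⟩
  ∑ (λ c → 𝟙 (P c) * μ)                            ≡˘⟨ *-distribʳ-sum μ (𝟙 ∘ P) ⟩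
  ∑ (𝟙 ∘ P) * μ                                    ≡˘⟨ cong (_* μ) (countRows≡∑ q P) ⟩
  countRows q P * μ                                ∎
  where
  open ≡-Reasoning
  indicator : Fin N → Fin q → ℕ
  indicator r c = 𝟙 (R r ∧ f r ≐ c)
  fibre′ : ∀ c → ∑ (λ r → indicator r c) ≡ μ
  fibre′ c = trans (sym (countRows≡∑ N _)) (fibre c)

∑𝟙≥1⇒∃ : ∀ {n} (P : Fin n → Bool) → 1 ≤ ∑ (𝟙 ∘ P) → ∃ λ r → T (P r)
∑𝟙≥1⇒∃ {suc n} P le with P zero in eq
... | true = zero , subst T (sym eq) _
... | false = Product.map suc id (∑𝟙≥1⇒∃ (P ∘ suc) le)

T⇒∑𝟙≥1 : ∀ {n} (P : Fin n → Bool) (r : Fin n) → T (P r) → 1 ≤ ∑ (𝟙 ∘ P)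
T⇒∑𝟙≥1 P zero t with P zero
... | true = s≤s z≤n
T⇒∑𝟙≥1 P (suc r) t = ≤-trans (T⇒∑𝟙≥1 (P ∘ suc) r t) (m≤n+m _ (𝟙 (P zero)))

countRows-≡-∃ : ∀ {N} {P Q : Fin N → Bool} → countRows N P ≡ countRows N Q →
  (∃ λ r → T (P r)) → ∃ λ r → T (Q r)
countRows-≡-∃ {N} {P} {Q} e (r , t) = ∑𝟙≥1⇒∃ Q (begin
  1                   ≤⟨ T⇒∑𝟙≥1 P r t ⟩
  ∑ (𝟙 ∘ P)           ≡˘⟨ countRows≡∑ N P ⟩
  countRows N P       ≡⟨ e ⟩
  countRows N Q       ≡⟨ countRows≡∑ N Q ⟩
  ∑ (𝟙 ∘ Q)           ∎)
  where open ≤-Reasoning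

-- Balanced and orthogonal columns

Balanced : ∀ {N l} → (Fin N → Fin l) → Set
Balanced {N} f = ∀ a a′ → countRows N (λ r → f r ≐ a) ≡ countRows N (λ r → f r ≐ a′)

Orthogonal : ∀ {N l m} → (Fin N → Fin l) → (Fin N → Fin m) → Set
Orthogonal {N} f g = ∀ a a′ b b′ →
  countRows N (λ r → f r ≐ a ∧ g r ≐ b) ≡ countRows N (λ r → f r ≐ a′ ∧ g r ≐ b′)

Balanced-resp : ∀ {N l} {f f′ : Fin N → Fin l} → (∀ r → f r ≡ f′ r) → Balanced f → Balanced f′
Balanced-resp f≗f′ bal a a′ =
  trans (countRows-cong λ r → cong (_≐ a) (sym (f≗f′ r)))
    (trans (bal a a′) (countRows-cong λ r → cong (_≐ a′) (f≗f′ r)))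

Orthogonal-resp : ∀ {N l m} {f f′ : Fin N → Fin l} {g g′ : Fin N → Fin m} →
  (∀ r → f r ≡ f′ r) → (∀ r → g r ≡ g′ r) → Orthogonal f g → Orthogonal f′ g′
Orthogonal-resp f≗f′ g≗g′ orth a a′ b b′ =
  trans (countRows-cong λ r → cong₂ (λ x y → x ≐ a ∧ y ≐ b) (sym (f≗f′ r)) (sym (g≗g′ r)))
    (trans (orth a a′ b b′) (countRows-cong λ r → cong₂ (λ x y → x ≐ a′ ∧ y ≐ b′) (f≗f′ r) (g≗g′ r)))

Orthogonal-sym : ∀ {N l m} (f : Fin N → Fin l) (g : Fin N → Fin m) → Orthogonal f g → Orthogonal g f
Orthogonal-sym f g orth b b′ a a′ =
  trans (countRows-cong λ r → ∧-comm (g r ≐ b) (f r ≐ a))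
    (trans (orth a a′ b b′) (countRows-cong λ r → ∧-comm (f r ≐ a′) (g r ≐ b′)))

Balanced⇒surjective : ∀ {N l} (f : Fin (suc N) → Fin l) → Balanced f → ∀ a → ∃ λ r → f r ≡ a
Balanced⇒surjective f bal a =
  Product.map₂ toWitness (countRows-≡-∃ (bal (f zero) a) (zero , ≐-refl (f zero)))

Orthogonal⇒surjective : ∀ {N l m} (f : Fin (suc N) → Fin l) (g : Fin (suc N) → Fin m) →
  Orthogonal f g → ∀ a b → ∃ λ r → f r ≡ a × g r ≡ b
Orthogonal⇒surjective f g orth a b =
  Product.map₂ witness
    (countRows-≡-∃ (orth (f zero) a (g zero) b) (zero , Equivalence.from T-∧ (≐-refl (f zero) , ≐-refl (g zero))))
  where
  witness : ∀ {r} → T (f r ≐ a ∧ g r ≐ b) → f r ≡ a × g r ≡ b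
  witness {r} t = Product.map toWitness toWitness (Equivalence.to (T-∧ {f r ≐ a}) t)

surjection⇒≤ : ∀ {m n} (f : Fin m → Fin n) → (∀ b → ∃ λ a → f a ≡ b) → n ≤ m
surjection⇒≤ f surj = injective⇒≤ λ {b} {b′} e →
  trans (sym (proj₂ (surj b))) (trans (cong f e) (proj₂ (surj b′)))

Balanced⇒≤ : ∀ {N l} (f : Fin (suc N) → Fin l) → Balanced f → l ≤ suc N
Balanced⇒≤ f bal = surjection⇒≤ f (Balanced⇒surjective f bal)

Orthogonal⇒*≤ : ∀ {N l m} (f : Fin (suc N) → Fin l) (g : Fin (suc N) → Fin m) →
  Orthogonal f g → l * m ≤ suc N
Orthogonal⇒*≤ {l = l} {m} f g orth = surjection⇒≤ (λ r → combine (f r) (g r)) λ k →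
  let r , fr , gr = Orthogonal⇒surjective f g orth (proj₁ (remQuot {l} m k)) (proj₂ (remQuot {l} m k))
  in r , trans (cong₂ combine fr gr) (combine-remQuot {l} m k)

countRows-pullback : ∀ {N q} (f : Fin N → Fin q) → Balanced f → {P P′ : Fin q → Bool} →
  countRows q P ≡ countRows q P′ → countRows N (P ∘ f) ≡ countRows N (P′ ∘ f)
countRows-pullback {zero} f _ _ = refl
countRows-pullback {suc N} {q} f bal {P} {P′} e = begin
  countRows (suc N) (P ∘ f)    ≡⟨ countRows-∘ f (λ _ → true) P (λ c → bal c (f zero)) ⟩
  countRows q P * μ            ≡⟨ cong (_* μ) e ⟩
  countRows q P′ * μ           ≡˘⟨ countRows-∘ f (λ _ → true) P′ (λ c → bal c (f zero)) ⟩
  countRows (suc N) (P′ ∘ f)   ∎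
  where
  open ≡-Reasoning
  μ = countRows (suc N) (λ r → f r ≐ f zero)

Orthogonal-∘ : ∀ {N q l m} (g : Fin N → Fin l) (f : Fin N → Fin q) (h : Fin q → Fin m) →
  Orthogonal g f → Balanced h → Orthogonal g (h ∘ f)
Orthogonal-∘ {zero} g f h _ _ _ _ _ _ = refl
Orthogonal-∘ {suc N} {q} g f h orth bal a a′ b b′ = begin
  countRows (suc N) (λ r → g r ≐ a ∧ h (f r) ≐ b)    ≡⟨ count a b ⟩
  countRows q (λ c → h c ≐ b) * μ a                  ≡⟨ cong₂ _*_ (bal b b′) (orth a a′ (f zero) (f zero)) ⟩
  countRows q (λ c → h c ≐ b′) * μ a′                ≡˘⟨ count a′ b′ ⟩
  countRows (suc N) (λ r → g r ≐ a′ ∧ h (f r) ≐ b′)  ∎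
  where
  open ≡-Reasoning
  μ : _ → ℕ
  μ a = countRows (suc N) (λ r → g r ≐ a ∧ f r ≐ f zero)
  count : ∀ a b → countRows (suc N) (λ r → g r ≐ a ∧ h (f r) ≐ b) ≡ countRows q (λ c → h c ≐ b) * μ a
  count a b = countRows-∘ f (λ r → g r ≐ a) (λ c → h c ≐ b) (λ c → orth a a c (f zero))

-- Realized parameter sets

IsOA-tail : ∀ {N} l ls (A : Array N (l ∷ ls)) → IsOA N (l ∷ ls) A → IsOA N ls (λ r j → A r (suc j))
IsOA-tail l ls A (bal , orth) = bal ∘ suc , λ i j i≢j → orth (suc i) (suc j) (i≢j ∘ Fin.suc-injective)

IsOA-∷ : ∀ {N} l ls (A : Array N (l ∷ ls)) →
  Balanced (λ r → A r zero) → IsOA N ls (λ r j → A r (suc j)) →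
  (∀ j → Orthogonal (λ r → A r zero) (λ r → A r (suc j))) → IsOA N (l ∷ ls) A
IsOA-∷ l ls A bal₀ (bal , orth) orth₀ = balanced , orthogonal
  where
  balanced : ∀ i → Balanced (λ r → A r i)
  balanced zero = bal₀
  balanced (suc i) = bal i
  orthogonal : ∀ i j → i ≢ j → Orthogonal (λ r → A r i) (λ r → A r j)
  orthogonal zero zero 0≢0 = contradiction refl 0≢0
  orthogonal zero (suc j) _ = orth₀ j
  orthogonal (suc i) zero _ = Orthogonal-sym (λ r → A r zero) (λ r → A r (suc i)) (orth₀ i)
  orthogonal (suc i) (suc j) i≢j = orth i j (i≢j ∘ cong suc)

appendᴬ : ∀ {N} Q L → Array N Q → Array N L → Array N (Q ++ L)
appendᴬ [] L X Y = Y
appendᴬ (_ ∷ Q) L X Y r zero = X r zero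
appendᴬ (_ ∷ Q) L X Y r (suc j) = appendᴬ Q L (λ r′ j′ → X r′ (suc j′)) Y r j

columns-appendᴬ : ∀ {N} Q L (X : Array N Q) (Y : Array N L) (Pr : ∀ {l} → (Fin N → Fin l) → Set) →
  (∀ i → Pr (λ r → X r i)) → (∀ j → Pr (λ r → Y r j)) → ∀ k → Pr (λ r → appendᴬ Q L X Y r k)
columns-appendᴬ [] L X Y Pr prX prY k = prY k
columns-appendᴬ (_ ∷ Q) L X Y Pr prX prY zero = prX zero
columns-appendᴬ (_ ∷ Q) L X Y Pr prX prY (suc k) =
  columns-appendᴬ Q L (λ r j → X r (suc j)) Y Pr (prX ∘ suc) prY k

IsOA-appendᴬ : ∀ {N} Q L (X : Array N Q) (Y : Array N L) → IsOA N Q X → IsOA N L Y →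
  (∀ i j → Orthogonal (λ r → X r i) (λ r → Y r j)) → IsOA N (Q ++ L) (appendᴬ Q L X Y)
IsOA-appendᴬ [] L X Y _ oaY _ = oaY
IsOA-appendᴬ (q ∷ Q) L X Y oaX oaY cross =
  IsOA-∷ q (Q ++ L) (appendᴬ (q ∷ Q) L X Y) (proj₁ oaX zero)
    (IsOA-appendᴬ Q L X′ Y (IsOA-tail q Q X oaX) oaY (cross ∘ suc))
    (columns-appendᴬ Q L X′ Y (Orthogonal (λ r → X r zero)) (λ i → proj₂ oaX zero (suc i) λ ()) (cross zero))
  where
  X′ : Array _ Q
  X′ r j = X r (suc j)

IsOA-∘ : ∀ {N q} L (f : Fin N → Fin q) (B : Array q L) →
  Balanced f → IsOA q L B → IsOA N L (λ r → B (f r))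
IsOA-∘ L f B bal (balB , orthB) =
  (λ j a a′ → countRows-pullback f bal (balB j a a′)) ,
  (λ i j i≢j a a′ b b′ → countRows-pullback f bal (orthB i j i≢j a a′ b b′))

Realized-replace : ∀ {N q} Q L → Realized N (q ∷ Q) → Realized q L → Realized N (Q ++ L)
Realized-replace {N} {q} Q L (_ ∷ Q≥2 , A , oaA) (L≥2 , B , oaB) =
  ++⁺ Q≥2 L≥2 , appendᴬ Q L A′ C ,
  IsOA-appendᴬ Q L A′ C (IsOA-tail q Q A oaA) (IsOA-∘ L (λ r → A r zero) B (proj₁ oaA zero) oaB) λ i j →
    Orthogonal-∘ (λ r → A′ r i) (λ r → A r zero) (λ c → B c j) (proj₂ oaA (suc i) zero λ ()) (proj₁ oaB j)
  where
  A′ : Array N Q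
  A′ r j = A r (suc j)
  C : Array N L
  C r = B (A r zero)

Realized-[] : ∀ N → Realized N []
Realized-[] N = [] , (λ _ ()) , (λ ()) , λ ()

Realized-single : ∀ s → 2 ≤ s → Realized s (s ∷ [])
Realized-single s s≥2 = s≥2 ∷ [] , identity , balanced , orthogonal
  where
  identity : Array s (s ∷ [])
  identity r zero = r
  balanced : ∀ i → Balanced (λ r → identity r i)
  balanced zero a a′ = trans (countRows-≐ s a) (sym (countRows-≐ s a′))
  orthogonal : ∀ i j → i ≢ j → Orthogonal (λ r → identity r i) (λ r → identity r j)
  orthogonal zero zero 0≢0 = contradiction refl 0≢0

is0 : ∀ {l} → Fin l → Fin 2
is0 zero = zero
is0 (suc _) = suc zero

is0-inject≤ : ∀ {l} (c : Fin 2) (l≥2 : 2 ≤ l) → is0 (inject≤ c l≥2) ≡ c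
is0-inject≤ zero (s≤s _) = refl
is0-inject≤ (suc zero) (s≤s (s≤s _)) = refl

funToFin-injective : ∀ {m n} {f g : Fin m → Fin n} → funToFin f ≡ funToFin g → ∀ x → f x ≡ g x
funToFin-injective {f = f} {g} e x =
  trans (sym (finToFun-funToFin f x)) (trans (cong (λ k → finToFun k x) e) (finToFun-funToFin g x))

-- Two distinct columns are orthogonal, so some row holds symbol 0 in one and symbol 1 in the other:
-- a column is determined by the set of rows holding symbol 0.
Realized⇒length≤ : ∀ {q L} → Realized (suc q) L → length L ≤ 2 ^ suc q
Realized⇒length≤ {q} {L} (L≥2 , A , _ , orth) = injective⇒≤ {f = rowsOf0} rowsOf0-injective
  where
  rowsOf0 : Fin (length L) → Fin (2 ^ suc q)
  rowsOf0 j = funToFin (λ r → is0 (A r j))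
  level≥2 : ∀ j → 2 ≤ lookup L j
  level≥2 j = All.lookup L≥2 (∈-lookup j)
  rowsOf0-injective : Injective _≡_ _≡_ rowsOf0
  rowsOf0-injective {i} {j} e with i ≟ j
  ... | yes i≡j = i≡j
  ... | no i≢j = contradiction 0≡1 λ ()
    where
    0F = inject≤ zero (level≥2 i)
    1F = inject≤ (suc zero) (level≥2 j)
    witness = Orthogonal⇒surjective (λ r → A r i) (λ r → A r j) (orth i j i≢j) 0F 1F
    r = proj₁ witness
    0≡1 : zero ≡ suc {1} zero
    0≡1 = begin
      zero         ≡˘⟨ is0-inject≤ zero (level≥2 i) ⟩
      is0 0F       ≡˘⟨ cong is0 (proj₁ (proj₂ witness)) ⟩
      is0 (A r i)  ≡⟨ funToFin-injective {f = λ r → is0 (A r i)} {λ r → is0 (A r j)} e r ⟩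
      is0 (A r j)  ≡⟨ cong is0 (proj₂ (proj₂ witness)) ⟩
      is0 1F       ≡⟨ is0-inject≤ (suc zero) (level≥2 j) ⟩
      suc zero     ∎
      where open ≡-Reasoning

Realized⇒levels< : ∀ {q L} → Realized (suc q) L → L ≢ suc q ∷ [] → All (_< suc q) L
Realized⇒levels< {L = []} _ _ = []
Realized⇒levels< {L = _ ∷ []} (_ , A , bal , _) L≢q =
  ≤∧≢⇒< (Balanced⇒≤ (λ r → A r zero) (bal zero)) (L≢q ∘ cong (_∷ [])) ∷ []
Realized⇒levels< {q} {L = L@(_ ∷ _ ∷ _)} (L≥2 , A , _ , orth) _ =
  subst (All (_< suc q)) (tabulate-lookup L) (tabulate⁺ level<)
  where
  partner : Fin (length L) → Fin (length L)
  partner zero = suc zero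
  partner (suc _) = zero
  partner-≢ : ∀ j → j ≢ partner j
  partner-≢ zero ()
  partner-≢ (suc _) ()
  level≥2 : ∀ j → 2 ≤ lookup L j
  level≥2 j = All.lookup L≥2 (∈-lookup j)
  level< : ∀ j → lookup L j < suc q
  level< j = begin-strict
    lookup L j
      <⟨ m<m*n (lookup L j) _ {{>-nonZero (<⇒≤ (level≥2 j))}} (level≥2 (partner j)) ⟩
    lookup L j * lookup L (partner j)
      ≤⟨ Orthogonal⇒*≤ (λ r → A r j) (λ r → A r (partner j)) (orth j (partner j) (partner-≢ j)) ⟩
    suc q
      ∎
    where open ≤-Reasoning

-- Deciding realizability

-- Relative to an equivalence, because dependent functions on Fin n can only be compared pointwise.
Searchable : (A : Set) → (A → A → Set) → Set₁
Searchable A _≈_ = (P : A → Set) → P Respects _≈_ → Decidable P → Dec (∃ P)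

Fin-searchable : ∀ {n} → Searchable (Fin n) _≡_
Fin-searchable P _ P? = any? P?

Π-searchable : ∀ {n} {B : Fin n → Set} {_≈_ : ∀ i → B i → B i → Set} →
  (∀ i → Reflexive (_≈_ i)) → (∀ i → Searchable (B i) (_≈_ i)) →
  Searchable ((i : Fin n) → B i) (λ f g → ∀ i → _≈_ i (f i) (g i))
Π-searchable {zero} {B} _ _ P resp P? = Dec.map′ (empty ,_) (λ (f , p) → resp {y = empty} (λ ()) p) (P? empty)
  where
  empty : (i : Fin 0) → B i
  empty ()
Π-searchable {suc n} {B} {_≈_} refl≈ search P resp P? =
  Dec.map′ (λ (b , g , p) → cons b g , p) (λ (f , p) → f zero , f ∘ suc , resp (cons-η f) p)
    (search zero (λ b → ∃ λ g → P (cons b g)) extends-resp extends?)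
  where
  cons : B zero → ((i : Fin n) → B (suc i)) → (i : Fin (suc n)) → B i
  cons b g zero = b
  cons b g (suc i) = g i
  cons-η : ∀ f i → _≈_ i (f i) (cons (f zero) (f ∘ suc) i)
  cons-η f zero = refl≈ zero
  cons-η f (suc i) = refl≈ (suc i)
  extends-resp : (λ b → ∃ λ g → P (cons b g)) Respects _≈_ zero
  extends-resp b≈b′ (g , p) = g , resp (λ { zero → b≈b′ ; (suc i) → refl≈ (suc i) }) p
  extends? : Decidable (λ b → ∃ λ g → P (cons b g))
  extends? b = Π-searchable (refl≈ ∘ suc) (search ∘ suc) (P ∘ cons b)
    (λ g≈g′ → resp λ { zero → refl≈ zero ; (suc i) → g≈g′ i }) (P? ∘ cons b)

IsOA-resp : ∀ {N ls} → IsOA N ls Respects (λ A A′ → ∀ r j → A r j ≡ A′ r j)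
IsOA-resp A≗A′ (bal , orth) =
  (λ i → Balanced-resp (λ r → A≗A′ r i) (bal i)) ,
  (λ i j i≢j → Orthogonal-resp (λ r → A≗A′ r i) (λ r → A≗A′ r j) (orth i j i≢j))

IsOA? : ∀ N ls → Decidable (IsOA N ls)
IsOA? N ls A =
  all? (λ i → all? λ a → all? λ a′ → _ ≟ℕ _) ×-dec
  all? (λ i → all? λ j → ¬? (i ≟ j) →-dec
    all? λ a → all? λ a′ → all? λ b → all? λ b′ → _ ≟ℕ _)

realized? : ∀ N ls → Dec (Realized N ls)
realized? N ls = All.all? (2 ≤?_) ls ×-dec
  Array-searchable (IsOA N ls) (IsOA-resp {ls = ls}) (IsOA? N ls)
  where
  Array-searchable : Searchable (Array N ls) (λ A A′ → ∀ r j → A r j ≡ A′ r j)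
  Array-searchable = Π-searchable (λ _ _ → refl) (λ _ → Π-searchable (λ _ → refl) (λ _ → Fin-searchable))

-- The height function

listsOfLength≤ : ∀ {A : Set} → ℕ → List A → List (List A)
listsOfLength≤ zero xs = [] ∷ []
listsOfLength≤ (suc n) xs = [] ∷ cartesianProductWith _∷_ xs (listsOfLength≤ n xs)

∈-listsOfLength≤ : ∀ {A : Set} {xs : List A} n ys → length ys ≤ n → All (_∈ xs) ys → ys ∈ listsOfLength≤ n xs
∈-listsOfLength≤ zero [] _ _ = here refl
∈-listsOfLength≤ (suc n) [] _ _ = here refl
∈-listsOfLength≤ (suc n) (y ∷ ys) (s≤s |ys|≤n) (y∈xs ∷ ys⊆xs) =
  there (∈-cartesianProductWith⁺ _∷_ y∈xs (∈-listsOfLength≤ n ys |ys|≤n ys⊆xs))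

All<⇒map-toℕ : ∀ {q} (L : List ℕ) → All (_< q) L → ∃ λ (L′ : List (Fin q)) → map toℕ L′ ≡ L
All<⇒map-toℕ [] [] = [] , refl
All<⇒map-toℕ (l ∷ L) (l<q ∷ L<q) =
  Product.map (fromℕ< l<q ∷_) (cong₂ _∷_ (toℕ-fromℕ< l<q)) (All<⇒map-toℕ L L<q)

-- For q ≥ 2 this lists every realized L ≠ (q), by Realized⇒levels< and Realized⇒length≤.
realizedBelow : (q : ℕ) → List (List (Fin q))
realizedBelow q = filter (realized? q ∘ map toℕ) (listsOfLength≤ (2 ^ q) (allFin q))

heightStep : (q : ℕ) → (∀ {l} → l < q → ℕ) → ℕ
heightStep q ht< = suc (max 0 (map (λ L → sum (map (λ l → ht< (toℕ<n l)) L)) (realizedBelow q)))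

-- Opaque so that type checking never unfolds the well-founded recursion (and with it the search
-- in realized?); ht-unfold is its only interface.
opaque
  ht : ℕ → ℕ
  ht = <-rec (λ _ → ℕ) heightStep

weight : Levels → ℕ
weight L = sum (map ht L)

maxWeightBelow : ℕ → ℕ
maxWeightBelow q = max 0 (map (weight ∘ map toℕ) (realizedBelow q))

opaque
  unfolding ht

  ht-unfold : ∀ q → ht q ≡ suc (maxWeightBelow q)
  ht-unfold q = trans (FixPoint.unfold-wfRec <-wellFounded (λ _ → ℕ) heightStep heightStep-ext {q})
    (cong (suc ∘ max 0) (map-cong (λ L → cong sum (map-∘ L)) (realizedBelow q)))
    where
    heightStep-ext : ∀ q {IH IH′ : ∀ {l} → l < q → ℕ} → (∀ {l} (l<q : l < q) → IH l<q ≡ IH′ l<q) →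
      heightStep q IH ≡ heightStep q IH′
    heightStep-ext q IH≗IH′ = cong (suc ∘ max 0)
      (map-cong (λ L → cong sum (map-cong (IH≗IH′ ∘ toℕ<n) L)) (realizedBelow q))

weight<ht : ∀ {q L} → 2 ≤ q → Realized q L → L ≢ q ∷ [] → weight L < ht q
weight<ht {suc q} {L} _ realized L≢q with All<⇒map-toℕ L (Realized⇒levels< realized L≢q)
... | L′ , refl = begin-strict
  weight (map toℕ L′)           ≤⟨ All.lookup (xs≤max 0 (map (weight ∘ map toℕ) _)) (∈-map⁺ (weight ∘ map toℕ) L′∈) ⟩
  maxWeightBelow (suc q)        <⟨ n<1+n (maxWeightBelow (suc q)) ⟩
  suc (maxWeightBelow (suc q))  ≡˘⟨ ht-unfold (suc q) ⟩
  ht (suc q)                    ∎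
  where
  open ≤-Reasoning
  |L′|≤ : length L′ ≤ 2 ^ suc q
  |L′|≤ = subst (_≤ _) (length-map toℕ L′) (Realized⇒length≤ realized)
  L′∈ : L′ ∈ realizedBelow (suc q)
  L′∈ = ∈-filter⁺ (realized? (suc q) ∘ map toℕ) (∈-listsOfLength≤ _ L′ |L′|≤ (All.tabulate λ {i} _ → ∈-allFin i)) realized

ht-attained : ∀ q → ∃ λ L → Realized q L × suc (weight L) ≡ ht q
ht-attained q with argmax-sel id 0 (map (weight ∘ map toℕ) (realizedBelow q))
... | inj₁ max≡0 = [] , Realized-[] q , sym (trans (ht-unfold q) (cong suc max≡0))
... | inj₂ max∈ with ∈-map⁻ (weight ∘ map toℕ) max∈
...   | L′ , L′∈ , max≡ = map toℕ L′ , realized , sym (trans (ht-unfold q) (cong suc max≡))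
  where
  realized : Realized q (map toℕ L′)
  realized = proj₂ (∈-filter⁻ (realized? q ∘ map toℕ) {xs = listsOfLength≤ (2 ^ q) (allFin q)} L′∈)

-- Heights in Λ_N

weight-++ : ∀ xs ys → weight (xs ++ ys) ≡ weight xs + weight ys
weight-++ xs ys = trans (cong sum (map-++ ht xs ys)) (sum-++ (map ht xs) (map ht ys))

weight-↭ : ∀ {xs ys} → xs ↭ ys → weight xs ≡ weight ys
weight-↭ xs↭ys = sum-↭ (map⁺ ht xs↭ys)

↭-removeAt : ∀ {A : Set} (xs : List A) i → xs ↭ lookup xs i ∷ removeAt xs i
↭-removeAt (x ∷ xs) zero = ↭-refl
↭-removeAt (x ∷ xs) (suc i) = ↭-trans (prep x (↭-removeAt xs i)) (swap x (lookup xs i) ↭-refl)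

Step-levels≥2 : ∀ {Q R} → All (2 ≤_) Q → Step Q R → All (2 ≤_) R
Step-levels≥2 {Q} Q≥2 (i , L , (L≥2 , _) , R↭) =
  All-resp-↭ (↭-sym R↭) (++⁺ (All.tail (All-resp-↭ (↭-removeAt Q i) Q≥2)) L≥2)

Step⇒↭⊎weight< : ∀ {Q R} → All (2 ≤_) Q → Step Q R → R ↭ Q ⊎ weight R < weight Q
Step⇒↭⊎weight< {Q} {R} Q≥2 (i , L , realized , R↭) with ≡-dec _≟ℕ_ L (lookup Q i ∷ [])
... | yes refl = inj₁ (↭-trans R↭ (↭-trans (++-comm (removeAt Q i) _) (↭-sym (↭-removeAt Q i))))
... | no L≢q = inj₂ (begin-strict
  weight R                                   ≡⟨ trans (weight-↭ R↭) (weight-++ (removeAt Q i) L) ⟩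
  weight (removeAt Q i) + weight L           <⟨ +-monoʳ-< _ (weight<ht (All.lookup Q≥2 (∈-lookup i)) realized L≢q) ⟩
  weight (removeAt Q i) + ht (lookup Q i)    ≡⟨ +-comm _ (ht (lookup Q i)) ⟩
  weight (lookup Q i ∷ removeAt Q i)         ≡˘⟨ weight-↭ (↭-removeAt Q i) ⟩
  weight Q                                   ∎)
  where open ≤-Reasoning

Reach⇒↭⊎weight< : ∀ {P Q} → All (2 ≤_) Q → Reach P Q → P ↭ Q ⊎ weight P < weight Q
Reach⇒↭⊎weight< _ (done P↭Q) = inj₁ P↭Q
Reach⇒↭⊎weight< Q≥2 (step st reach)
  with Reach⇒↭⊎weight< (Step-levels≥2 Q≥2 st) reach | Step⇒↭⊎weight< Q≥2 st
... | inj₁ P↭R | inj₁ R↭Q = inj₁ (↭-trans P↭R R↭Q)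
... | inj₁ P↭R | inj₂ R<Q = inj₂ (≤-trans (≤-reflexive (cong suc (weight-↭ P↭R))) R<Q)
... | inj₂ P<R | inj₁ R↭Q = inj₂ (≤-trans P<R (≤-reflexive (weight-↭ R↭Q)))
... | inj₂ P<R | inj₂ R<Q = inj₂ (<-trans P<R R<Q)

StrictDom⇒weight< : ∀ {N P Q} → StrictDom N P Q → weight P < weight Q
StrictDom⇒weight< ((realP , realQ , reach) , Q⋠P) with Reach⇒↭⊎weight< (proj₁ realQ) reach
... | inj₁ P↭Q = contradiction (realQ , realP , done (↭-sym P↭Q)) Q⋠P
... | inj₂ P<Q = P<Q

DownPath⇒≤weight : ∀ {N Q m} → DownPath N Q m → m ≤ weight Q
DownPath⇒≤weight bottom = z≤n
DownPath⇒≤weight (down cover path) = ≤-trans (s≤s (DownPath⇒≤weight path)) (StrictDom⇒weight< (proj₁ cover))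

Step⇒Covers : ∀ {N P Q} → Realized N P → Realized N Q → Step Q P →
  suc (weight P) ≡ weight Q → Covers N P Q
Step⇒Covers realP realQ st drop = ((realP , realQ , step st (done ↭-refl)) , Q⋠P) , nothing-between
  where
  Q⋠P : ¬ Dom _ _ _
  Q⋠P (_ , _ , reach) with Reach⇒↭⊎weight< (proj₁ realP) reach
  ... | inj₁ Q↭P = <-irrefl (weight-↭ (↭-sym Q↭P)) (≤-reflexive drop)
  ... | inj₂ Q<P = <-asym Q<P (≤-reflexive drop)
  nothing-between : ∀ Z → StrictDom _ _ Z → StrictDom _ Z _ → ⊥
  nothing-between Z P<Z Z<Q =
    <⇒≱ (StrictDom⇒weight< P<Z) (≤-pred (≤-trans (StrictDom⇒weight< Z<Q) (≤-reflexive (sym drop))))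

DownPath-weight : ∀ {N} n {Q} → Realized N Q → weight Q ≡ n → DownPath N Q n
DownPath-weight zero {[]} _ _ = bottom
DownPath-weight zero {q ∷ Q} _ w≡0 = contradiction (trans (cong (_+ weight Q) (sym (ht-unfold q))) w≡0) λ ()
DownPath-weight (suc n) {[]} _ ()
DownPath-weight (suc n) {q ∷ Q} realized w≡1+n =
  down (Step⇒Covers realP realized (zero , L , realL , ↭-refl) drop)
    (DownPath-weight n realP (suc-injective (trans drop w≡1+n)))
  where
  L = proj₁ (ht-attained q)
  realL = proj₁ (proj₂ (ht-attained q))
  realP = Realized-replace Q L realized realL
  drop : suc (weight (Q ++ L)) ≡ weight (q ∷ Q)
  drop = begin
    suc (weight (Q ++ L))         ≡⟨ cong suc (trans (weight-++ Q L) (+-comm (weight Q) (weight L))) ⟩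
    suc (weight L) + weight Q     ≡⟨ cong (_+ weight Q) (proj₂ (proj₂ (ht-attained q))) ⟩
    ht q + weight Q               ∎
    where open ≡-Reasoning

IsHeight-weight : ∀ {N Q} → Realized N Q → IsHeight N Q (weight Q)
IsHeight-weight realized = DownPath-weight _ realized refl , λ _ → DownPath⇒≤weight

weight-replicate : ∀ k x → weight (replicate k x) ≡ k * ht x
weight-replicate zero x = refl
weight-replicate (suc k) x = cong (ht x +_) (weight-replicate k x)

weight-concatMap : ∀ {A : Set} (g : A → Levels) xs → weight (concatMap g xs) ≡ sum (map (weight ∘ g) xs)
weight-concatMap g [] = refl
weight-concatMap g (x ∷ xs) =
  trans (weight-++ (g x) (concatMap g xs)) (cong (weight (g x) +_) (weight-concatMap g xs))

lemma1 : (v : ℕ) (s k : Fin v → ℕ) (N : ℕ) →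
    Injective _≡_ _≡_ s → (∀ i → 2 ≤ s i) → (∀ i → 1 ≤ k i) →
    Realized N (levelsOf v s k) →
    Σ (Fin v → ℕ) λ ht →
      (∀ i → IsHeight (s i) (s i ∷ []) (ht i)) ×
      IsHeight N (levelsOf v s k) (ΣFin v (λ i → k i * ht i))
lemma1 v s k N _ s≥2 _ realized =
  ht ∘ s ,
  (λ i → subst (IsHeight (s i) (s i ∷ [])) (+-identityʳ (ht (s i)))
           (IsHeight-weight (Realized-single (s i) (s≥2 i)))) ,
  subst (IsHeight N (levelsOf v s k)) weight≡ (IsHeight-weight realized)
  where
  weight≡ : weight (levelsOf v s k) ≡ ΣFin v (λ i → k i * ht (s i))
  weight≡ = trans (weight-concatMap (λ i → replicate (k i) (s i)) (allFin v))
    (cong sum (map-cong (λ i → weight-replicate (k i) (s i)) (allFin v)))
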